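{- Let $\{(X_n,C_n,f_n(q))\}_{n\ge1}$ be a Lyndon-like family of instances of the cyclic sieving phenomenon. Then there are unique non-negative integers $\{t_d\}_{d\ge1}$ such that $|X_n|=\sum_{d\mid n} d\,t_d$ for every $n\ge1$.
   Context: A triple $(X,C_n,f(q))$, $C_n=\langle g\rangle$ cyclic of order $n$ acting on the finite set $X$, $f$ a polynomial with non-negative integer coefficients, exhibits the cyclic sieving phenomenon (CSP) if $f(\omega_n^k)=|\{x\in X: g^k\cdot x=x\}|$ for all $k\in\{1,\dots,n\}$, $\omega_n=e^{2\pi i/n}$. A family $\{(X_n,C_n,f_n(q))\}_{n\ge1}$ of CSP instances, where $C_n$ is cyclic of order $n$, is Lyndon-like if $f_{n/m}(1)=f_n(e^{2\pi i/m})$ for all positive integers $m,n$ with $m\mid n$; equivalently, for every $d\mid n$ the number of elements of $X_n$ fixed by $g^d$ equals $|X_d|$. The integers $t_d$ are called the Lyndon parameters of the family. -}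

module Defs where

open import Data.Nat using (ℕ; zero; suc; _*_; _≤_)
open import Data.Nat.Divisibility using (_∣_; _∣?_)
open import Data.Nat.GeneralisedArithmetic using (iterate)
open import Data.Fin using (Fin; _≟_)
open import Data.Fin.Permutation using (Permutation′; _⟨$⟩ʳ_)
open import Data.List using (List; length; filter; map; upTo; allFin)
open import Data.Nat.ListAction using (sum)
open import Relation.Binary.PropositionalEquality using (_≡_)

-- A finite set X with |X| = size, identified with Fin size, carrying an
-- action of the cyclic group C_n = ⟨g⟩ of order n: the generator g acts by
-- the permutation gen, and g^n acts trivially.
record CyclicAction (n : ℕ) : Set where
  field
    size  : ℕ
    gen   : Permutation′ size
    order : ∀ (x : Fin size) → iterate (gen ⟨$⟩ʳ_) x n ≡ x

open CyclicAction public

act^ : ∀ {n} (A : CyclicAction n) → ℕ → Fin (size A) → Fin (size A)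
act^ A k x = iterate (gen A ⟨$⟩ʳ_) x k

fixCount : ∀ {n} (A : CyclicAction n) → ℕ → ℕ
fixCount A k = length (filter (λ x → act^ A k x ≟ x) (allFin (size A)))

divisors : ℕ → List ℕ
divisors n = filter (λ d → d ∣? n) (map suc (upTo n))

divisorSum : ℕ → (ℕ → ℕ) → ℕ
divisorSum n h = sum (map h (divisors n))

-- A family {(X_n, C_n)}_{n ≥ 1} (index 0 is unused) is Lyndon-like iff for
-- every n ≥ 1 and d ∣ n, the number of elements of X_n fixed by g^d is |X_d|.
-- (This is the equivalent form of f_{n/d}(1) = f_n(ω_d) given in the paper,
-- using the CSP for the instances.)
LyndonLike : ((n : ℕ) → CyclicAction n) → Set
LyndonLike X = ∀ (n d : ℕ) → 1 ≤ n → d ∣ n → fixCount (X n) d ≡ size (X d)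

module Submission where

-- For a cyclic action of order n ≥ 1 on a finite set X, every x has a
-- period p(x), the least k ≥ 1 with gᵏ·x = x, and gᵈ·x = x iff p(x) ∣ d.
-- Writing c(e) for the number of points of period e, this gives
--   (1)  |Fix(gᵈ)| = Σ_{e ∣ d} c(e)                 (d ≥ 1),
-- and since the points of full period n form orbits of size n,
--   (2)  n ∣ c(n),
-- proved by double counting: each such orbit contains exactly one point
-- that is least in its orbit for the order of Fin |X|.  Independently,
--   (3)  a function h on ℕ⁺ is determined at d by the divisor sums
--        Σ_{e′ ∣ e} h(e′) for the divisors e of d.
-- For a Lyndon-like family, (1) shows that the period counts c_n of X_n and
-- c_d of X_d (d ∣ n) have the same divisor sums at every divisor of d, so
-- c_n(d) = c_d(d) by (3).  With t_d = c_d(d) / d, an integer by (2), the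
-- case d = n of (1) reads |X_n| = Σ_{d ∣ n} d·t_d; uniqueness of t is (3).

open import Data.Nat
  using (ℕ; zero; suc; _+_; _*_; _∸_; _≤_; _<_; _%_; _/_; z≤n; s≤s; NonZero; _≟_; _≤?_)
open import Data.Nat.Properties
  using ( +-comm; +-assoc; +-identityʳ; *-comm; +-cancelˡ-≡; *-cancelˡ-≡
        ; ≤-refl; ≤-trans; ≤-antisym; ≤-pred; <⇒≤; <⇒≢; ≰⇒>; ≤-<-trans; <-cmp
        ; m≤n⇒m≤1+n; m≤n⇒m<n∨m≡n; m∸n≤m; m<n⇒0<n∸m; m+[n∸m]≡n; allUpTo?
        ; +-0-commutativeMonoid )
open import Data.Nat.Divisibility using (_∣_; _∣?_; divides; ∣-refl; ∣-trans; ∣-antisym; ∣⇒≤; m%n≡0⇒n∣m)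
open import Data.Nat.DivMod using (m≡m%n+[m/n]*n; m%n<n; m*[n/m]≡n)
open import Data.Nat.Induction using (<-rec)
open import Data.Nat.GeneralisedArithmetic using (iterate)
open import Data.Nat.ListAction using (sum)
open import Data.Nat.ListAction.Properties using (sum-++)
open import Data.Fin using (Fin; toℕ; fromℕ<) renaming (zero to fzero; suc to fsuc; _≟_ to _≟ᶠ_)
open import Data.Fin.Properties using (0≢1+n; suc-injective; toℕ-injective; toℕ<n; toℕ-fromℕ<)
open import Data.Fin.Permutation using (Permutation′; _⟨$⟩ʳ_; _∘ₚ_) renaming (id to idₚ)
open import Data.List using (List; _++_; [_]; map; filter; length; upTo; tabulate)
open import Data.List.Properties using (upTo-∷ʳ; map-++; filter-++)
open import Data.Product using (Σ; _×_; _,_; proj₁; proj₂)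
open import Data.Sum using (inj₁; inj₂)
open import Data.Empty using (⊥-elim)
open import Function using (_∘_; id)
open import Relation.Binary.Definitions using (tri<; tri≈; tri>)
open import Relation.Nullary using (Dec; yes; no; ¬_; _×-dec_)
open import Relation.Binary.PropositionalEquality
  using (_≡_; _≢_; refl; sym; trans; cong; cong₂; subst; module ≡-Reasoning)
open import Algebra.Properties.CommutativeMonoid.Sum +-0-commutativeMonoid
  using (sum-syntax; ∑-comm; ∑-permute; sum-cong-≗; ∑-distrib-+; sum-replicate-zero)
open import Defs

open ≡-Reasoning

private
  variable
    A B : Set

𝟙 : Dec A → ℕ
𝟙 (yes _) = 1
𝟙 (no _)  = 0

onlyIf : Dec A → ℕ → ℕ
onlyIf (yes _) m = m
onlyIf (no _)  _ = 0

𝟙-yes : (d : Dec A) → A → 𝟙 d ≡ 1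
𝟙-yes (yes _) _ = refl
𝟙-yes (no ¬a) a = ⊥-elim (¬a a)

𝟙-no : (d : Dec A) → ¬ A → 𝟙 d ≡ 0
𝟙-no (yes a) ¬a = ⊥-elim (¬a a)
𝟙-no (no _)  _  = refl

𝟙-cong : (d : Dec A) (d′ : Dec B) → (A → B) → (B → A) → 𝟙 d ≡ 𝟙 d′
𝟙-cong (yes _) (yes _)  _ _ = refl
𝟙-cong (yes a) (no ¬b)  f _ = ⊥-elim (¬b (f a))
𝟙-cong (no ¬a) (yes b)  _ g = ⊥-elim (¬a (g b))
𝟙-cong (no _)  (no _)   _ _ = refl

onlyIf-yes : ∀ {m} (d : Dec A) → A → onlyIf d m ≡ m
onlyIf-yes (yes _) _ = refl
onlyIf-yes (no ¬a) a = ⊥-elim (¬a a)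

onlyIf-zero : (d : Dec A) → onlyIf d 0 ≡ 0
onlyIf-zero (yes _) = refl
onlyIf-zero (no _)  = refl

onlyIf-cong : ∀ {m m′} (d : Dec A) → (A → m ≡ m′) → onlyIf d m ≡ onlyIf d m′
onlyIf-cong (yes a) eq = eq a
onlyIf-cong (no _)  _  = refl

count-filter : ∀ {s} {P : A → Set} (P? : ∀ a → Dec (P a)) (g : Fin s → A) →
               length (filter P? (tabulate g)) ≡ ∑[ i < s ] 𝟙 (P? (g i))
count-filter {s = zero}  P? g = refl
count-filter {s = suc s} P? g with P? (g fzero)
... | yes _ = cong suc (count-filter P? (g ∘ fsuc))
... | no _  = count-filter P? (g ∘ fsuc)

∑-const : ∀ k a → ∑[ _ < k ] a ≡ k * a
∑-const zero    a = refl
∑-const (suc k) a = cong (a +_) (∑-const k a)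

∑-onlyIf : ∀ {s} (d : Dec A) (v : Fin s → ℕ) →
           ∑[ i < s ] onlyIf d (v i) ≡ onlyIf d (∑[ i < s ] v i)
∑-onlyIf (yes _) v = refl
∑-onlyIf {s = s} (no _) v = sum-replicate-zero s

∑-𝟙-none : ∀ {k} {Q : Fin k → Set} (Q? : ∀ i → Dec (Q i)) → (∀ i → ¬ Q i) →
           ∑[ i < k ] 𝟙 (Q? i) ≡ 0
∑-𝟙-none {k = zero}  Q? none = refl
∑-𝟙-none {k = suc k} Q? none =
  cong₂ _+_ (𝟙-no (Q? fzero) (none fzero)) (∑-𝟙-none (Q? ∘ fsuc) (none ∘ fsuc))

∑-𝟙-unique : ∀ {k} {Q : Fin k → Set} (Q? : ∀ i → Dec (Q i)) (i₀ : Fin k) → Q i₀ →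
             (∀ i j → Q i → Q j → i ≡ j) → ∑[ i < k ] 𝟙 (Q? i) ≡ 1
∑-𝟙-unique Q? fzero q₀ unique =
  cong₂ _+_ (𝟙-yes (Q? fzero) q₀)
            (∑-𝟙-none (Q? ∘ fsuc) (λ i q → 0≢1+n (unique fzero (fsuc i) q₀ q)))
∑-𝟙-unique Q? (fsuc i₀) q₀ unique =
  cong₂ _+_ (𝟙-no (Q? fzero) (λ q → 0≢1+n (unique fzero (fsuc i₀) q q₀)))
            (∑-𝟙-unique (Q? ∘ fsuc) i₀ q₀ (λ i j p q → suc-injective (unique (fsuc i) (fsuc j) p q)))

argmin : ∀ {k} (h : Fin (suc k) → ℕ) → Σ (Fin (suc k)) (λ i₀ → ∀ i → h i₀ ≤ h i)
argmin {k = zero} h = fzero , λ { fzero → ≤-refl }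
argmin {k = suc k} h with argmin (h ∘ fsuc)
... | j , j-min with h fzero ≤? h (fsuc j)
...   | yes h0≤ = fzero , λ { fzero → ≤-refl ; (fsuc i) → ≤-trans h0≤ (j-min i) }
...   | no h0≰  = fsuc j , λ { fzero → <⇒≤ (≰⇒> h0≰) ; (fsuc i) → j-min i }

oneTo : ℕ → List ℕ
oneTo k = map suc (upTo k)

oneTo-suc : ∀ k → oneTo (suc k) ≡ oneTo k ++ [ suc k ]
oneTo-suc k = trans (cong (map suc) (sym (upTo-∷ʳ k))) (map-++ suc (upTo k) [ k ])

module RestrictedSum {P : ℕ → Set} (P? : ∀ e → Dec (P e)) where

  sumOver : ℕ → (ℕ → ℕ) → ℕ
  sumOver k h = sum (map h (filter P? (oneTo k)))

  sumOver-suc : ∀ k h → sumOver (suc k) h ≡ sumOver k h + onlyIf (P? (suc k)) (h (suc k))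
  sumOver-suc k h = begin
      sum (map h (filter P? (oneTo (suc k))))
    ≡⟨ cong (λ l → sum (map h (filter P? l))) (oneTo-suc k) ⟩
      sum (map h (filter P? (oneTo k ++ [ suc k ])))
    ≡⟨ cong (sum ∘ map h) (filter-++ P? (oneTo k) [ suc k ]) ⟩
      sum (map h (filter P? (oneTo k) ++ filter P? [ suc k ]))
    ≡⟨ cong sum (map-++ h (filter P? (oneTo k)) (filter P? [ suc k ])) ⟩
      sum (map h (filter P? (oneTo k)) ++ map h (filter P? [ suc k ]))
    ≡⟨ sum-++ (map h (filter P? (oneTo k))) (map h (filter P? [ suc k ])) ⟩
      sumOver k h + sum (map h (filter P? [ suc k ]))
    ≡⟨ cong (sumOver k h +_) last-term ⟩
      sumOver k h + onlyIf (P? (suc k)) (h (suc k)) ∎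
    where
    last-term : sum (map h (filter P? [ suc k ])) ≡ onlyIf (P? (suc k)) (h (suc k))
    last-term with P? (suc k)
    ... | yes _ = +-identityʳ (h (suc k))
    ... | no _  = refl

  sumOver-cong : ∀ k h h′ → (∀ e → 1 ≤ e → e ≤ k → P e → h e ≡ h′ e) → sumOver k h ≡ sumOver k h′
  sumOver-cong zero    h h′ agree = refl
  sumOver-cong (suc k) h h′ agree = begin
      sumOver (suc k) h
    ≡⟨ sumOver-suc k h ⟩
      sumOver k h + onlyIf (P? (suc k)) (h (suc k))
    ≡⟨ cong₂ _+_ (sumOver-cong k h h′ (λ e 1≤e e≤k → agree e 1≤e (m≤n⇒m≤1+n e≤k)))
                 (onlyIf-cong (P? (suc k)) (agree (suc k) (s≤s z≤n) ≤-refl)) ⟩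
      sumOver k h′ + onlyIf (P? (suc k)) (h′ (suc k))
    ≡⟨ sumOver-suc k h′ ⟨
      sumOver (suc k) h′ ∎

  sumOver-vanishing : ∀ k h → (∀ e → 1 ≤ e → e ≤ k → P e → h e ≡ 0) → sumOver k h ≡ 0
  sumOver-vanishing zero    h vanish = refl
  sumOver-vanishing (suc k) h vanish = trans (sumOver-suc k h)
    (cong₂ _+_ (sumOver-vanishing k h (λ e 1≤e e≤k → vanish e 1≤e (m≤n⇒m≤1+n e≤k)))
               (trans (onlyIf-cong (P? (suc k)) (vanish (suc k) (s≤s z≤n) ≤-refl)) (onlyIf-zero (P? (suc k)))))

  sumOver-∑ : ∀ {s} (g : Fin s → ℕ → ℕ) k →
              ∑[ x < s ] sumOver k (g x) ≡ sumOver k (λ e → ∑[ x < s ] g x e)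
  sumOver-∑ {s = s} g zero    = sum-replicate-zero s
  sumOver-∑ {s = s} g (suc k) = begin
      ∑[ x < s ] sumOver (suc k) (g x)
    ≡⟨ sum-cong-≗ (λ x → sumOver-suc k (g x)) ⟩
      ∑[ x < s ] (sumOver k (g x) + onlyIf (P? (suc k)) (g x (suc k)))
    ≡⟨ ∑-distrib-+ (λ x → sumOver k (g x)) (λ x → onlyIf (P? (suc k)) (g x (suc k))) ⟩
      ∑[ x < s ] sumOver k (g x) + ∑[ x < s ] onlyIf (P? (suc k)) (g x (suc k))
    ≡⟨ cong₂ _+_ (sumOver-∑ g k) (∑-onlyIf (P? (suc k)) (λ x → g x (suc k))) ⟩
      sumOver k (λ e → ∑[ x < s ] g x e) + onlyIf (P? (suc k)) (∑[ x < s ] g x (suc k))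
    ≡⟨ sumOver-suc k (λ e → ∑[ x < s ] g x e) ⟨
      sumOver (suc k) (λ e → ∑[ x < s ] g x e) ∎

  sumOver-point : ∀ a k → 1 ≤ a → a ≤ k → P a → sumOver k (λ e → 𝟙 (a ≟ e)) ≡ 1
  sumOver-point (suc _) zero _ () _
  sumOver-point a (suc k) 1≤a a≤1+k pa with m≤n⇒m<n∨m≡n a≤1+k
  ... | inj₁ a<1+k = trans (sumOver-suc k _)
        (cong₂ _+_ (sumOver-point a k 1≤a (≤-pred a<1+k) pa)
                   (trans (onlyIf-cong (P? (suc k)) (λ _ → 𝟙-no (a ≟ suc k) (<⇒≢ a<1+k)))
                          (onlyIf-zero (P? (suc k)))))
  ... | inj₂ refl = trans (sumOver-suc k _)
        (cong₂ _+_ (sumOver-vanishing k _ (λ e _ e≤k _ → 𝟙-no (suc k ≟ e) (λ a≡e → <⇒≢ (s≤s e≤k) (sym a≡e))))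
                   (trans (onlyIf-yes (P? (suc k)) pa) (𝟙-yes (suc k ≟ suc k) refl)))

open RestrictedSum using (sumOver; sumOver-suc; sumOver-cong; sumOver-vanishing; sumOver-∑; sumOver-point)

-- Divisor sums

divisorSum-split : ∀ k h → divisorSum (suc k) h ≡ sumOver (_∣? suc k) k h + h (suc k)
divisorSum-split k h =
  trans (sumOver-suc (_∣? suc k) k h) (cong (sumOver (_∣? suc k) k h +_) (onlyIf-yes (suc k ∣? suc k) ∣-refl))

𝟙-∣-as-divisorSum : ∀ a d → 1 ≤ a → 𝟙 (a ∣? suc d) ≡ divisorSum (suc d) (λ e → 𝟙 (a ≟ e))
𝟙-∣-as-divisorSum a d 1≤a with a ∣? suc d
... | yes a∣d = sym (sumOver-point (_∣? suc d) a (suc d) 1≤a (∣⇒≤ a∣d) a∣d)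
... | no  a∤d = sym (sumOver-vanishing (_∣? suc d) (suc d) _
                       (λ e _ _ e∣d → 𝟙-no (a ≟ e) (λ { refl → a∤d e∣d })))

-- Fact (3): the values of h at the divisors of d are determined by the
-- divisor sums of h at the divisors of d (strong induction on d, peeling
-- off the last term of divisorSum d).
divisorSum-injective : ∀ (h h′ : ℕ → ℕ) d → 1 ≤ d →
                       (∀ e → 1 ≤ e → e ∣ d → divisorSum e h ≡ divisorSum e h′) → h d ≡ h′ d
divisorSum-injective h h′ = <-rec Goal step
  where
  Goal : ℕ → Set
  Goal d = 1 ≤ d → (∀ e → 1 ≤ e → e ∣ d → divisorSum e h ≡ divisorSum e h′) → h d ≡ h′ d

  step : ∀ d → (∀ {e} → e < d → Goal e) → Goal d
  step (suc k) below _ sums = +-cancelˡ-≡ (sumOver (_∣? suc k) k h) (h (suc k)) (h′ (suc k)) (begin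
      sumOver (_∣? suc k) k h + h (suc k)    ≡⟨ divisorSum-split k h ⟨
      divisorSum (suc k) h                   ≡⟨ sums (suc k) (s≤s z≤n) ∣-refl ⟩
      divisorSum (suc k) h′                  ≡⟨ divisorSum-split k h′ ⟩
      sumOver (_∣? suc k) k h′ + h′ (suc k)  ≡⟨ cong (_+ h′ (suc k)) properDivisors ⟨
      sumOver (_∣? suc k) k h + h′ (suc k)   ∎)
    where
    properDivisors : sumOver (_∣? suc k) k h ≡ sumOver (_∣? suc k) k h′
    properDivisors = sumOver-cong (_∣? suc k) k h h′ (λ e 1≤e e≤k e∣d →
      below (s≤s e≤k) 1≤e (λ e′ 1≤e′ e′∣e → sums e′ 1≤e′ (∣-trans e′∣e e∣d)))

least≤ : {P : ℕ → Set} → (∀ k → Dec (P k)) → ℕ → ℕ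
least≤ P? zero = zero
least≤ P? (suc b) with P? zero
... | yes _ = zero
... | no _  = suc (least≤ (P? ∘ suc) b)

least≤-minimal : {P : ℕ → Set} (P? : ∀ k → Dec (P k)) → ∀ b k → k < least≤ P? b → ¬ P k
least≤-minimal P? (suc b) k k<least with P? zero
least≤-minimal P? (suc b) zero    _           | no ¬p0 = ¬p0
least≤-minimal P? (suc b) (suc k) (s≤s k<least) | no _ = least≤-minimal (P? ∘ suc) b k k<least

least≤-satisfies : {P : ℕ → Set} (P? : ∀ k → Dec (P k)) → ∀ b j → j ≤ b → P j → P (least≤ P? b)
least≤-satisfies P? zero    .zero z≤n pj = pj
least≤-satisfies P? (suc b) j     j≤b pj with P? zero
... | yes p0 = p0
least≤-satisfies P? (suc b) zero    _         pj | no ¬p0 = ⊥-elim (¬p0 pj)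
least≤-satisfies P? (suc b) (suc j) (s≤s j≤b) pj | no _   = least≤-satisfies (P? ∘ suc) b j j≤b pj

iterate-+ : ∀ (f : A → A) x a b → iterate f x (a + b) ≡ iterate f (iterate f x a) b
iterate-+ f x zero    b = refl
iterate-+ f x (suc a) b = iterate-+ f (f x) a b

-- A single cyclic action of order n = suc m on X = Fin s

module CyclicActionTheory {m : ℕ} (A : CyclicAction (suc m)) where

  private
    n s : ℕ
    n = suc m
    s = size A

  g^_·_ : ℕ → Fin s → Fin s
  g^ k · x = act^ A k x

  g^-+ : ∀ a b x → g^ (a + b) · x ≡ g^ b · (g^ a · x)
  g^-+ a b x = iterate-+ (gen A ⟨$⟩ʳ_) x a b

  g^-comm : ∀ a b x → g^ a · (g^ b · x) ≡ g^ b · (g^ a · x)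
  g^-comm a b x = trans (sym (g^-+ b a x)) (trans (cong (λ k → g^ k · x) (+-comm b a)) (g^-+ a b x))

  g^n : ∀ x → g^ n · x ≡ x
  g^n = order A

  fixed-* : ∀ {k x} → g^ k · x ≡ x → ∀ q → g^ (q * k) · x ≡ x
  fixed-*         fix zero    = refl
  fixed-* {k} {x} fix (suc q) =
    trans (g^-+ k (q * k) x) (trans (cong (λ y → g^ (q * k) · y) fix) (fixed-* fix q))

  fixed-% : ∀ {k x} .{{_ : NonZero k}} → g^ k · x ≡ x → ∀ a → g^ a · x ≡ g^ (a % k) · x
  fixed-% {k} {x} fix a = begin
      g^ a · x                             ≡⟨ cong (λ b → g^ b · x) (trans (m≡m%n+[m/n]*n a k) (+-comm (a % k) _)) ⟩
      g^ (a / k * k + a % k) · x           ≡⟨ g^-+ (a / k * k) (a % k) x ⟩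
      g^ (a % k) · (g^ (a / k * k) · x)    ≡⟨ cong (λ y → g^ (a % k) · y) (fixed-* fix (a / k)) ⟩
      g^ (a % k) · x                       ∎

  fixed-along : ∀ {i x} j → g^ i · x ≡ x → g^ i · (g^ j · x) ≡ g^ j · x
  fixed-along {i} {x} j fix = trans (g^-comm i j x) (cong (λ y → g^ j · y) fix)

  g^-undo : ∀ x j → j ≤ n → g^ (n ∸ j) · (g^ j · x) ≡ x
  g^-undo x j j≤n = trans (sym (g^-+ j (n ∸ j) x)) (trans (cong (λ k → g^ k · x) (m+[n∸m]≡n j≤n)) (g^n x))

  -- The period of x: the least k ≥ 1 with gᵏ·x = x (at most n since gⁿ = 1).
  period : Fin s → ℕ
  period x = suc (least≤ (λ k → g^ suc k · x ≟ᶠ x) m)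

  period-fixes : ∀ x → g^ period x · x ≡ x
  period-fixes x = least≤-satisfies (λ k → g^ suc k · x ≟ᶠ x) m m ≤-refl (g^n x)

  period-least : ∀ x i → 1 ≤ i → i < period x → g^ i · x ≢ x
  period-least x (suc i) _ (s≤s i<least) = least≤-minimal (λ k → g^ suc k · x ≟ᶠ x) m i i<least

  period∣⇒fixed : ∀ x d → period x ∣ d → g^ d · x ≡ x
  period∣⇒fixed x d (divides q d≡q*p) = trans (cong (λ k → g^ k · x) d≡q*p) (fixed-* (period-fixes x) q)

  fixed⇒period∣ : ∀ x d → g^ d · x ≡ x → period x ∣ d
  fixed⇒period∣ x d fix = m%n≡0⇒n∣m d (period x)
    (remainder-zero (d % period x) (m%n<n d (period x)) (trans (sym (fixed-% (period-fixes x) d)) fix))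
    where
    remainder-zero : ∀ r → r < period x → g^ r · x ≡ x → r ≡ 0
    remainder-zero zero    _   _   = refl
    remainder-zero (suc r) r<p fix = ⊥-elim (period-least x (suc r) (s≤s z≤n) r<p fix)

  period-shift : ∀ x j → j ≤ n → period (g^ j · x) ≡ period x
  period-shift x j j≤n = ∣-antisym
    (fixed⇒period∣ (g^ j · x) (period x) (fixed-along {i = period x} j (period-fixes x)))
    (fixed⇒period∣ x (period (g^ j · x))
      (subst (λ y → g^ period (g^ j · x) · y ≡ y) (g^-undo x j j≤n)
             (fixed-along {i = period (g^ j · x)} (n ∸ j) (period-fixes (g^ j · x)))))

  periodCount : ℕ → ℕ
  periodCount e = ∑[ x < s ] 𝟙 (period x ≟ e)

  fixCount-by-period : ∀ d → fixCount A (suc d) ≡ divisorSum (suc d) periodCount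
  fixCount-by-period d = begin
      fixCount A (suc d)
    ≡⟨ count-filter (λ x → g^ suc d · x ≟ᶠ x) id ⟩
      ∑[ x < s ] 𝟙 (g^ suc d · x ≟ᶠ x)
    ≡⟨ sum-cong-≗ (λ x → 𝟙-cong (g^ suc d · x ≟ᶠ x) (period x ∣? suc d)
                                 (fixed⇒period∣ x (suc d)) (period∣⇒fixed x (suc d))) ⟩
      ∑[ x < s ] 𝟙 (period x ∣? suc d)
    ≡⟨ sum-cong-≗ (λ x → 𝟙-∣-as-divisorSum (period x) d (s≤s z≤n)) ⟩
      ∑[ x < s ] divisorSum (suc d) (λ e → 𝟙 (period x ≟ e))
    ≡⟨ sumOver-∑ (_∣? suc d) (λ x e → 𝟙 (period x ≟ e)) (suc d) ⟩
      divisorSum (suc d) periodCount ∎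

  OrbitMin : Fin s → Set
  OrbitMin y = period y ≡ n × (∀ {j} → j < n → toℕ y ≤ toℕ (g^ j · y))

  orbitMin? : ∀ y → Dec (OrbitMin y)
  orbitMin? y = (period y ≟ n) ×-dec allUpTo? (λ j → toℕ y ≤? toℕ (g^ j · y)) n

  orbit-reach : ∀ x k l → k ≤ n → g^ l · x ≡ g^ ((l + (n ∸ k)) % n) · (g^ k · x)
  orbit-reach x k l k≤n = begin
      g^ l · x                              ≡⟨ g^n (g^ l · x) ⟨
      g^ n · (g^ l · x)                     ≡⟨ g^-+ l n x ⟨
      g^ (l + n) · x                        ≡⟨ cong (λ i → g^ i · x) exponents ⟩
      g^ (k + (l + (n ∸ k))) · x            ≡⟨ g^-+ k (l + (n ∸ k)) x ⟩
      g^ (l + (n ∸ k)) · (g^ k · x)         ≡⟨ fixed-% (g^n (g^ k · x)) (l + (n ∸ k)) ⟩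
      g^ ((l + (n ∸ k)) % n) · (g^ k · x)   ∎
    where
    exponents : l + n ≡ k + (l + (n ∸ k))
    exponents = begin
      l + n                 ≡⟨ cong (l +_) (m+[n∸m]≡n k≤n) ⟨
      l + (k + (n ∸ k))     ≡⟨ +-assoc l k (n ∸ k) ⟨
      l + k + (n ∸ k)       ≡⟨ cong (_+ (n ∸ k)) (+-comm l k) ⟩
      k + l + (n ∸ k)       ≡⟨ +-assoc k l (n ∸ k) ⟩
      k + (l + (n ∸ k))     ∎

  orbitMin-least : ∀ x k l → k ≤ n → OrbitMin (g^ k · x) → toℕ (g^ k · x) ≤ toℕ (g^ l · x)
  orbitMin-least x k l k≤n (_ , least) =
    subst (λ y → toℕ (g^ k · x) ≤ toℕ y) (sym (orbit-reach x k l k≤n)) (least (m%n<n (l + (n ∸ k)) n))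

  orbit-injective : ∀ x k l → k < l → l < n → period (g^ k · x) ≡ n → g^ k · x ≢ g^ l · x
  orbit-injective x k l k<l l<n full same = period-least (g^ k · x) (l ∸ k) (m<n⇒0<n∸m k<l)
    (subst (l ∸ k <_) (sym full) (≤-<-trans (m∸n≤m l k) l<n))
    (trans (sym (g^-+ k (l ∸ k) x)) (trans (cong (λ i → g^ i · x) (m+[n∸m]≡n (<⇒≤ k<l))) (sym same)))

  orbitMin-exists : ∀ x → period x ≡ n → Σ (Fin n) (λ i → OrbitMin (g^ toℕ i · x))
  orbitMin-exists x full = i₀ , trans (period-shift x k₀ (<⇒≤ (toℕ<n i₀))) full , least
    where
    minimum = argmin (λ i → toℕ (g^ toℕ i · x))
    i₀ = proj₁ minimum
    k₀ = toℕ i₀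

    least : ∀ {j} → j < n → toℕ (g^ k₀ · x) ≤ toℕ (g^ j · (g^ k₀ · x))
    least {j} _ = subst (λ y → toℕ (g^ k₀ · x) ≤ toℕ y) (sym reach) (proj₂ minimum (fromℕ< k₀+j%n<n))
      where
      k₀+j%n<n = m%n<n (k₀ + j) n
      reach : g^ j · (g^ k₀ · x) ≡ g^ toℕ (fromℕ< k₀+j%n<n) · x
      reach = trans (sym (g^-+ k₀ j x))
                (trans (fixed-% (g^n x) (k₀ + j)) (cong (λ i → g^ i · x) (sym (toℕ-fromℕ< k₀+j%n<n))))

  orbitMin-same : ∀ x k l → k ≤ n → l ≤ n → OrbitMin (g^ k · x) → OrbitMin (g^ l · x) → g^ k · x ≡ g^ l · x
  orbitMin-same x k l k≤n l≤n min-k min-l =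
    toℕ-injective (≤-antisym (orbitMin-least x k l k≤n min-k) (orbitMin-least x l k l≤n min-l))

  orbitMin-unique : ∀ x (i j : Fin n) → OrbitMin (g^ toℕ i · x) → OrbitMin (g^ toℕ j · x) → i ≡ j
  orbitMin-unique x i j min-i min-j with <-cmp (toℕ i) (toℕ j)
  ... | tri< i<j _ _ = ⊥-elim (orbit-injective x (toℕ i) (toℕ j) i<j (toℕ<n j) (proj₁ min-i)
                         (orbitMin-same x (toℕ i) (toℕ j) (<⇒≤ (toℕ<n i)) (<⇒≤ (toℕ<n j)) min-i min-j))
  ... | tri≈ _ i≡j _ = toℕ-injective i≡j
  ... | tri> _ _ j<i = ⊥-elim (orbit-injective x (toℕ j) (toℕ i) j<i (toℕ<n i) (proj₁ min-j)
                         (orbitMin-same x (toℕ j) (toℕ i) (<⇒≤ (toℕ<n j)) (<⇒≤ (toℕ<n i)) min-j min-i))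

  orbitMin-count : ∀ x → ∑[ k < n ] 𝟙 (orbitMin? (g^ toℕ k · x)) ≡ 𝟙 (period x ≟ n)
  orbitMin-count x = by-period (period x ≟ n)
    where
    -- split on the decision itself: a 'with' would also abstract it inside
    -- the k = 0 summand orbitMin? x
    by-period : (full? : Dec (period x ≡ n)) → ∑[ k < n ] 𝟙 (orbitMin? (g^ toℕ k · x)) ≡ 𝟙 full?
    by-period (yes full) = ∑-𝟙-unique (λ k → orbitMin? (g^ toℕ k · x))
      (proj₁ (orbitMin-exists x full)) (proj₂ (orbitMin-exists x full)) (orbitMin-unique x)
    by-period (no ¬full) = ∑-𝟙-none (λ k → orbitMin? (g^ toℕ k · x))
      (λ k min-k → ¬full (trans (sym (period-shift x (toℕ k) (<⇒≤ (toℕ<n k)))) (proj₁ min-k)))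

  -- gᵏ as a permutation of X, so that sums over X are invariant under it.
  g^-perm : ℕ → Permutation′ s
  g^-perm zero    = idₚ
  g^-perm (suc k) = gen A ∘ₚ g^-perm k

  g^-perm-apply : ∀ k x → g^-perm k ⟨$⟩ʳ x ≡ g^ k · x
  g^-perm-apply zero    x = refl
  g^-perm-apply (suc k) x = g^-perm-apply k (gen A ⟨$⟩ʳ x)

  ∑-translate : ∀ (v : Fin s → ℕ) k → ∑[ x < s ] v (g^ k · x) ≡ ∑[ x < s ] v x
  ∑-translate v k = sym (trans (∑-permute v (g^-perm k)) (sum-cong-≗ (λ x → cong v (g^-perm-apply k x))))

  -- Fact (2): n ∣ c(n), by counting pairs (x, k) with k < n and gᵏ·x OrbitMin.
  n∣periodCount : n ∣ periodCount n
  n∣periodCount = divides orbitMinCount (begin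
      periodCount n                                          ≡⟨ sum-cong-≗ (λ x → orbitMin-count x) ⟨
      ∑[ x < s ] ∑[ k < n ] 𝟙 (orbitMin? (g^ toℕ k · x))    ≡⟨ ∑-comm {s} {n} (λ x k → 𝟙 (orbitMin? (g^ toℕ k · x))) ⟩
      ∑[ k < n ] ∑[ x < s ] 𝟙 (orbitMin? (g^ toℕ k · x))    ≡⟨ sum-cong-≗ {n} (λ k → ∑-translate (𝟙 ∘ orbitMin?) (toℕ k)) ⟩
      ∑[ k < n ] orbitMinCount                               ≡⟨ ∑-const n orbitMinCount ⟩
      n * orbitMinCount                                      ≡⟨ *-comm n orbitMinCount ⟩
      orbitMinCount * n                                      ∎)
    where
    orbitMinCount : ℕ
    orbitMinCount = ∑[ y < s ] 𝟙 (orbitMin? y)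

open CyclicActionTheory using (periodCount; fixCount-by-period; n∣periodCount)

-- Lyndon-like families

module LyndonLikeFamily (X : (n : ℕ) → CyclicAction n) (lyndon : LyndonLike X) where

  c : ℕ → ℕ → ℕ
  c zero    _ = 0
  c (suc m) e = periodCount (X (suc m)) e

  fixCount-as-divisorSum : ∀ n d → 1 ≤ n → 1 ≤ d → fixCount (X n) d ≡ divisorSum d (c n)
  fixCount-as-divisorSum (suc m) (suc d) _ _ = fixCount-by-period (X (suc m)) d

  -- For d ∣ n, the points of period d are counted alike in X_n and X_d:
  -- both period counts have divisor sums |X_e| at every e ∣ d.
  c-stable : ∀ n d → 1 ≤ n → 1 ≤ d → d ∣ n → c n d ≡ c d d
  c-stable n d 1≤n 1≤d d∣n = divisorSum-injective (c n) (c d) d 1≤d (λ e 1≤e e∣d → begin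
      divisorSum e (c n)   ≡⟨ fixCount-as-divisorSum n e 1≤n 1≤e ⟨
      fixCount (X n) e     ≡⟨ lyndon n e 1≤n (∣-trans e∣d d∣n) ⟩
      size (X e)           ≡⟨ lyndon d e 1≤d e∣d ⟨
      fixCount (X d) e     ≡⟨ fixCount-as-divisorSum d e 1≤d 1≤e ⟩
      divisorSum e (c d)   ∎)

  t : ℕ → ℕ
  t zero    = 0
  t (suc m) = c (suc m) (suc m) / suc m

  d*t : ∀ d → 1 ≤ d → d * t d ≡ c d d
  d*t (suc m) _ = m*[n/m]≡n (n∣periodCount (X (suc m)))

  t-represents : ∀ n → 1 ≤ n → size (X n) ≡ divisorSum n (λ d → d * t d)
  t-represents n 1≤n = begin
      size (X n)                    ≡⟨ lyndon n n 1≤n ∣-refl ⟨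
      fixCount (X n) n              ≡⟨ fixCount-as-divisorSum n n 1≤n 1≤n ⟩
      divisorSum n (c n)            ≡⟨ sumOver-cong (_∣? n) n (c n) (λ d → d * t d)
                                         (λ d 1≤d _ d∣n → trans (c-stable n d 1≤n 1≤d d∣n) (sym (d*t d 1≤d))) ⟩
      divisorSum n (λ d → d * t d)  ∎

  -- Any representation has the same divisor sums d·t′_d as d·t_d, hence t′ = t by (3).
  t-unique : ∀ (t′ : ℕ → ℕ) → (∀ n → 1 ≤ n → size (X n) ≡ divisorSum n (λ d → d * t′ d)) →
             ∀ d → 1 ≤ d → t′ d ≡ t d
  t-unique t′ t′-represents (suc m) 1≤d = *-cancelˡ-≡ (t′ (suc m)) (t (suc m)) (suc m)
    (divisorSum-injective (λ d → d * t′ d) (λ d → d * t d) (suc m) 1≤d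
      (λ e 1≤e _ → trans (sym (t′-represents e 1≤e)) (t-represents e 1≤e)))

lemma7p2 : (X : (n : ℕ) → CyclicAction n) → LyndonLike X →
    Σ (ℕ → ℕ) (λ t →
      (∀ (n : ℕ) → 1 ≤ n → size (X n) ≡ divisorSum n (λ d → d * t d)) ×
      (∀ (t′ : ℕ → ℕ) →
        (∀ (n : ℕ) → 1 ≤ n → size (X n) ≡ divisorSum n (λ d → d * t′ d)) →
        ∀ (d : ℕ) → 1 ≤ d → t′ d ≡ t d))
lemma7p2 X lyndon = t , t-represents , t-unique
  where open LyndonLikeFamily X lyndon
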